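{- Let $n$ be an even positive integer, $0<p\le 1$, and $i\ge0$ an integer with $i\le p\sqrt{n-2i+2}$. Then $$\sum_{\substack{0\le j\le i\\ i-j\ \text{even}}}(2p)^j\binom{n/2}{j,\ \frac{n-i-j}{2},\ \frac{i-j}{2}}\le\frac{1}{1-\frac{i(i-1)}{2p^2(n-2i+2)}}\,(2p)^i\binom{n/2}{i}.$$
   Context: $\binom{N}{a,b,c}=\frac{N!}{a!\,b!\,c!}$ for nonnegative integers with $a+b+c=N$ (and is $0$ if some entry is negative).
   Formalization: The parameter p takes only rational values in the interval 0 < p ≤ 1. -}

module Defs where

open import Data.Nat as ℕ using (ℕ; zero; suc; _+_; _∸_; _!)
open import Data.Nat.Properties using (_!≢0; m*n≢0)
open import Data.Nat.Combinatorics using (_C_)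
open import Data.Integer using (+_)
open import Data.Rational as ℚ using (ℚ; 0ℚ; 1ℚ)
open import Data.List using (List; map; foldr; upTo)
open import Relation.Nullary using (yes; no)

ℕ→ℚ : ℕ → ℚ
ℕ→ℚ n = ℚ._/_ (+ n) 1

_^ℚ_ : ℚ → ℕ → ℚ
x ^ℚ zero  = 1ℚ
x ^ℚ suc k = x ℚ.* (x ^ℚ k)

-- multinomial coefficient (N ; a, b, c) = N! / (a! b! c!) if a+b+c = N, else 0.
-- (Arguments are natural numbers; a "negative" entry can only arise below as a
--  truncated subtraction, in which case a+b+c ≠ N and the value is 0, as required.)
multinomial : ℕ → ℕ → ℕ → ℕ → ℕ
multinomial N a b c with a + b + c ℕ.≟ N
... | yes _ = ℕ._/_ (N !) ((a ! ℕ.* b !) ℕ.* c !)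
                {{m*n≢0 (a ! ℕ.* b !) (c !) {{m*n≢0 (a !) (b !) {{a !≢0}} {{b !≢0}}}} {{c !≢0}}}}
... | no _  = 0

sumℚ : List ℚ → ℚ
sumℚ = foldr ℚ._+_ 0ℚ

-- summand of the left-hand side, for N = n/2 (so n = 2N), index i, parameter p,
-- summation index j; it is 0 unless i - j is even (and j ≤ i, ensured by the range).
lhsTerm : ℕ → ℚ → ℕ → ℕ → ℚ
lhsTerm N p i j with ℕ._%_ (i ∸ j) 2 ℕ.≟ 0
... | yes _ = ((ℕ→ℚ 2 ℚ.* p) ^ℚ j) ℚ.*
              ℕ→ℚ (multinomial N j (ℕ._/_ ((2 ℕ.* N) ∸ i ∸ j) 2) (ℕ._/_ (i ∸ j) 2))
... | no _  = 0ℚ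

lhsSum : ℕ → ℚ → ℕ → ℚ
lhsSum N p i = sumℚ (map (lhsTerm N p i) (upTo (suc i)))

{-# OPTIONS --safe #-}

-- Put N = i + t and let U j be the j-th summand.  U j vanishes when i - j is odd.  When
-- i - j = 2(c + 1), the factorial identity
--   (N; j, c+1+t, c+1) (c+1+t)(c+1) = (N; j+2, c+t, c) (j+2)(j+1)
-- together with (c+1+t)(c+1) ≥ t+1 and (j+2)(j+1) ≤ i(i-1) = 4p²(t+1)·d gives U j ≤ d · U (j+2).
-- Since q = 1 + q d, the bound  U 0 + … + U (m+1) ≤ q U (m+1) + q U m  then propagates
-- upwards, and at m + 1 = i the term q U (i-1) is zero while U i = (2p)^i (N choose i).
-- The hypothesis i² ≤ p²(n - 2i + 2) makes d < 1, hence q ≥ 1, and excludes i = N + 1.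

module Submission where

open import Defs
open import Data.Nat as ℕ using (ℕ; _+_; _∸_)
open import Data.Nat.Combinatorics using (_C_)
open import Data.Rational as ℚ using (ℚ; 0ℚ; 1ℚ; _<_; _≤_; _*_; _-_)
open import Relation.Binary.PropositionalEquality using (_≡_)

open import Data.Nat using (zero; suc; _!; s≤s; s≤s⁻¹; z≤n)
open import Data.Nat.Properties as ℕ
  using (_!≢0; m*n≢0; m+n∸m≡n; m+n∸n≡m; m≤m+n; m≤n⇒∃[o]m+o≡n; m+[n∸m]≡n)
open import Data.Nat.Combinatorics using (k![n∸k]!∣n!; nCk≡n!/k![n-k]!)
open import Data.Nat.Divisibility using (_∣_; ∣-trans; *-monoˡ-∣)
open import Data.Nat.DivMod using (_%_; _/_; m/n*n≡m; m*n/n≡m; m*n%n≡0; [m+kn]%n≡m%n)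
open import Data.Nat.Coprimality using (1-coprimeTo)
import Data.Nat.Coprimality as Coprime
import Data.Nat.Tactic.RingSolver as ℕ-Solver
open import Data.Integer as ℤ using (+_)
import Data.Integer.Properties as ℤ
open import Data.Rational using (mkℚ; *≤*; Positive; NonNegative; positive; nonNegative)
open import Data.Rational.Properties as ℚ
  using ( normalize-coprime; normalize-pos; +-*-commutativeRing
        ; *-monoˡ-≤-nonNeg; *-monoʳ-≤-nonNeg; *-cancelʳ-≤-pos; *-cancelʳ-<-nonNeg; pos⇒nonNeg
        ; nonNeg*nonNeg⇒nonNeg; pos*pos⇒pos; positive⁻¹; nonNegative⁻¹)
open import Data.List using ([]; _∷_; [_]; _++_; map; upTo)
open import Data.List.Properties using (upTo-∷ʳ; map-++)
open import Data.Product using (∃-syntax; _,_)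
open import Data.Sum using (_⊎_; inj₁; inj₂)
open import Data.Empty using (⊥-elim)
open import Level using (0ℓ)
open import Relation.Nullary using (yes; no; contradiction)
open import Relation.Nullary.Decidable using (dec⇒maybe)
open import Relation.Binary.PropositionalEquality
  using (refl; sym; trans; cong; cong₂; subst; subst₂; module ≡-Reasoning)
open import Tactic.RingSolver using (solve-∀)
open import Tactic.RingSolver.Core.AlmostCommutativeRing using (AlmostCommutativeRing; fromCommutativeRing)

ℚ-ring : AlmostCommutativeRing 0ℓ 0ℓ
ℚ-ring = fromCommutativeRing +-*-commutativeRing (λ x → dec⇒maybe (0ℚ ℚ.≟ x))

ℕ→ℚ≡mkℚ : ∀ n → ℕ→ℚ n ≡ mkℚ (+ n) 0 (Coprime.sym (1-coprimeTo n))
ℕ→ℚ≡mkℚ n = normalize-coprime (Coprime.sym (1-coprimeTo n))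

ℕ→ℚ-homo-* : ∀ m n → ℕ→ℚ (m ℕ.* n) ≡ ℕ→ℚ m * ℕ→ℚ n
ℕ→ℚ-homo-* m n = begin
  ℕ→ℚ (m ℕ.* n)         ≡⟨ cong (ℚ._/ 1) (ℤ.pos-* m n) ⟩
  (+ m ℤ.* + n) ℚ./ 1   ≡⟨ cong₂ _*_ (ℕ→ℚ≡mkℚ m) (ℕ→ℚ≡mkℚ n) ⟨
  ℕ→ℚ m * ℕ→ℚ n         ∎
  where open ≡-Reasoning

ℕ→ℚ-mono-≤ : ∀ {m n} → m ℕ.≤ n → ℕ→ℚ m ≤ ℕ→ℚ n
ℕ→ℚ-mono-≤ {m} {n} m≤n = subst₂ _≤_ (sym (ℕ→ℚ≡mkℚ m)) (sym (ℕ→ℚ≡mkℚ n))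
  (*≤* (subst₂ ℤ._≤_ (sym (ℤ.*-identityʳ (+ m))) (sym (ℤ.*-identityʳ (+ n))) (ℤ.+≤+ m≤n)))

ℕ→ℚ-nonNeg : ∀ n → 0ℚ ≤ ℕ→ℚ n
ℕ→ℚ-nonNeg n = ℕ→ℚ-mono-≤ {0} {n} z≤n

ℕ→ℚ-pos : ∀ n .{{_ : ℕ.NonZero n}} → Positive (ℕ→ℚ n)
ℕ→ℚ-pos n = normalize-pos n 1

*-nonNeg : ∀ {x y} → 0ℚ ≤ x → 0ℚ ≤ y → 0ℚ ≤ x * y
*-nonNeg {x} {y} x≥0 y≥0 =
  nonNegative⁻¹ _ {{nonNeg*nonNeg⇒nonNeg x {{nonNegative x≥0}} y {{nonNegative y≥0}}}}

^ℚ-nonNeg : ∀ {x} → 0ℚ ≤ x → ∀ j → 0ℚ ≤ x ^ℚ j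
^ℚ-nonNeg x≥0 zero    = ℕ→ℚ-nonNeg 1
^ℚ-nonNeg x≥0 (suc j) = *-nonNeg x≥0 (^ℚ-nonNeg x≥0 j)

x≤q*x : ∀ {q x} → 1ℚ ≤ q → 0ℚ ≤ x → x ≤ q * x
x≤q*x {q} {x} 1≤q x≥0 =
  subst (_≤ q * x) (ℚ.*-identityˡ x) (*-monoʳ-≤-nonNeg x {{nonNegative x≥0}} 1≤q)

sumℚ-∷ʳ : ∀ xs y → sumℚ (xs ++ [ y ]) ≡ sumℚ xs ℚ.+ y
sumℚ-∷ʳ []       y = trans (ℚ.+-identityʳ y) (sym (ℚ.+-identityˡ y))
sumℚ-∷ʳ (x ∷ xs) y = trans (cong (x ℚ.+_) (sumℚ-∷ʳ xs y)) (sym (ℚ.+-assoc x (sumℚ xs) y))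

sumℚ-upTo-suc : ∀ (f : ℕ → ℚ) n → sumℚ (map f (upTo (suc n))) ≡ sumℚ (map f (upTo n)) ℚ.+ f n
sumℚ-upTo-suc f n = begin
  sumℚ (map f (upTo (suc n)))          ≡⟨ cong (λ js → sumℚ (map f js)) (upTo-∷ʳ n) ⟨
  sumℚ (map f (upTo n ++ [ n ]))       ≡⟨ cong sumℚ (map-++ f (upTo n) [ n ]) ⟩
  sumℚ (map f (upTo n) ++ [ f n ])     ≡⟨ sumℚ-∷ʳ (map f (upTo n)) (f n) ⟩
  sumℚ (map f (upTo n)) ℚ.+ f n        ∎
  where open ≡-Reasoning

module _ (U : ℕ → ℚ) (U≥0 : ∀ j → 0ℚ ≤ U j) {d q : ℚ} (1≤q : 1ℚ ≤ q) (q≡1+qd : q ≡ 1ℚ ℚ.+ q * d) where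

  sumℚ-upTo-≤-last-two : ∀ n → (∀ j → 2 + j ℕ.≤ suc n → U j ≤ d * U (2 + j)) →
    sumℚ (map U (upTo (2 + n))) ≤ q * U (suc n) ℚ.+ q * U n
  sumℚ-upTo-≤-last-two zero _ = begin
    U 0 ℚ.+ (U 1 ℚ.+ 0ℚ)    ≡⟨ swap (U 0) (U 1) ⟩
    U 1 ℚ.+ U 0             ≤⟨ ℚ.+-mono-≤ (x≤q*x 1≤q (U≥0 1)) (x≤q*x 1≤q (U≥0 0)) ⟩
    q * U 1 ℚ.+ q * U 0     ∎
    where
    open ℚ.≤-Reasoning
    swap : ∀ a b → a ℚ.+ (b ℚ.+ 0ℚ) ≡ b ℚ.+ a
    swap = solve-∀ ℚ-ring
  sumℚ-upTo-≤-last-two (suc n) step = begin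
    sumℚ (map U (upTo (3 + n)))                          ≡⟨ sumℚ-upTo-suc U (2 + n) ⟩
    sumℚ (map U (upTo (2 + n))) ℚ.+ U (2 + n)
      ≤⟨ ℚ.+-monoˡ-≤ (U (2 + n)) (sumℚ-upTo-≤-last-two n (λ j 2+j≤1+n → step j (ℕ.m≤n⇒m≤1+n 2+j≤1+n))) ⟩
    q * U (1 + n) ℚ.+ q * U n ℚ.+ U (2 + n)
      ≤⟨ ℚ.+-monoˡ-≤ (U (2 + n)) (ℚ.+-monoʳ-≤ (q * U (1 + n)) (*-monoˡ-≤-nonNeg q {{q≥0}} (step n ℕ.≤-refl))) ⟩
    q * U (1 + n) ℚ.+ q * (d * U (2 + n)) ℚ.+ U (2 + n)  ≡⟨ regroup q d (U (1 + n)) (U (2 + n)) ⟩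
    (1ℚ ℚ.+ q * d) * U (2 + n) ℚ.+ q * U (1 + n)         ≡⟨ cong (λ r → r * U (2 + n) ℚ.+ q * U (1 + n)) q≡1+qd ⟨
    q * U (2 + n) ℚ.+ q * U (1 + n)                      ∎
    where
    open ℚ.≤-Reasoning
    q≥0 : NonNegative q
    q≥0 = nonNegative (ℚ.≤-trans (ℕ→ℚ-nonNeg 1) 1≤q)
    regroup : ∀ q d a b → q * a ℚ.+ q * (d * b) ℚ.+ b ≡ (1ℚ ℚ.+ q * d) * b ℚ.+ q * a
    regroup = solve-∀ ℚ-ring

module QuotientBounds {a M d : ℚ} .{{_ : Positive a}} .{{_ : Positive M}} {r : ℕ}
         (d-def : d * (ℕ→ℚ 2 * a * M) ≡ ℕ→ℚ r) where

  private
    2aM>0 : Positive (ℕ→ℚ 2 * a * M)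
    2aM>0 = pos*pos⇒pos (ℕ→ℚ 2 * a) {{pos*pos⇒pos (ℕ→ℚ 2) {{ℕ→ℚ-pos 2}} a}} M

  quotient-nonNeg : 0ℚ ≤ d
  quotient-nonNeg = *-cancelʳ-≤-pos (ℕ→ℚ 2 * a * M) {{2aM>0}}
    (subst₂ _≤_ (sym (ℚ.*-zeroˡ (ℕ→ℚ 2 * a * M))) (sym d-def) (ℕ→ℚ-nonNeg r))

  quotient-<1 : ℕ→ℚ r ≤ a * M → d < 1ℚ
  quotient-<1 r≤aM = *-cancelʳ-<-nonNeg (ℕ→ℚ 2 * a * M) {{pos⇒nonNeg (ℕ→ℚ 2 * a * M) {{2aM>0}}}} (begin-strict
    d * (ℕ→ℚ 2 * a * M)       ≡⟨ d-def ⟩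
    ℕ→ℚ r                     ≤⟨ r≤aM ⟩
    a * M                     ≡⟨ ℚ.+-identityʳ (a * M) ⟨
    a * M ℚ.+ 0ℚ              <⟨ ℚ.+-monoʳ-< (a * M) (positive⁻¹ (a * M) {{pos*pos⇒pos a M}}) ⟩
    a * M ℚ.+ a * M           ≡⟨ double a M ⟩
    1ℚ * (ℕ→ℚ 2 * a * M)      ∎)
    where
    open ℚ.≤-Reasoning
    -- The closed terms ℕ→ℚ 2 and 1ℚ ℚ.+ 1ℚ normalise to the same rational.
    double : ∀ a M → a * M ℚ.+ a * M ≡ 1ℚ * ((1ℚ ℚ.+ 1ℚ) * a * M)
    double = solve-∀ ℚ-ring

q*[1-d]≡1⇒q≡1+q*d : ∀ {d q} → q * (1ℚ - d) ≡ 1ℚ → q ≡ 1ℚ ℚ.+ q * d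
q*[1-d]≡1⇒q≡1+q*d {d} {q} q*[1-d]≡1 = trans (split q d) (cong (ℚ._+ q * d) q*[1-d]≡1)
  where
  split : ∀ q d → q ≡ q * (1ℚ - d) ℚ.+ q * d
  split = solve-∀ ℚ-ring

q*[1-d]≡1⇒1≤q : ∀ {d q} → 0ℚ ≤ d → d < 1ℚ → q * (1ℚ - d) ≡ 1ℚ → 1ℚ ≤ q
q*[1-d]≡1⇒1≤q {d} {q} d≥0 d<1 q*[1-d]≡1 = begin
  1ℚ               ≡⟨ ℚ.+-identityʳ 1ℚ ⟨
  1ℚ ℚ.+ 0ℚ        ≤⟨ ℚ.+-monoʳ-≤ 1ℚ (*-nonNeg (ℚ.<⇒≤ q>0) d≥0) ⟩
  1ℚ ℚ.+ q * d     ≡⟨ q*[1-d]≡1⇒q≡1+q*d q*[1-d]≡1 ⟨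
  q                ∎
  where
  open ℚ.≤-Reasoning
  1-d>0 : 0ℚ < 1ℚ - d
  1-d>0 = subst (_< 1ℚ - d) (ℚ.+-inverseʳ d) (ℚ.+-monoˡ-< (ℚ.- d) d<1)
  q>0 : 0ℚ < q
  q>0 = *-cancelʳ-<-nonNeg (1ℚ - d) {{nonNegative (ℚ.<⇒≤ 1-d>0)}}
          (subst₂ _<_ (sym (ℚ.*-zeroˡ (1ℚ - d))) (sym q*[1-d]≡1) (positive⁻¹ 1ℚ))

a!*b!≢0 : ∀ a b → ℕ.NonZero (a ! ℕ.* b !)
a!*b!≢0 a b = m*n≢0 (a !) (b !) {{a !≢0}} {{b !≢0}}

a!*b!*c!≢0 : ∀ a b c → ℕ.NonZero (a ! ℕ.* b ! ℕ.* c !)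
a!*b!*c!≢0 a b c = m*n≢0 (a ! ℕ.* b !) (c !) {{a!*b!≢0 a b}} {{c !≢0}}

binomial-∣ : ∀ a b → a ! ℕ.* b ! ∣ (a + b) !
binomial-∣ a b = subst (λ c → a ! ℕ.* c ! ∣ (a + b) !) (m+n∸m≡n a b) (k![n∸k]!∣n! (m≤m+n a b))

multinomial-∣ : ∀ a b c → a ! ℕ.* b ! ℕ.* c ! ∣ (a + b + c) !
multinomial-∣ a b c = ∣-trans (*-monoˡ-∣ (c !) (binomial-∣ a b)) (binomial-∣ (a + b) c)

multinomial-spec : ∀ {N} a b c → a + b + c ≡ N → multinomial N a b c ℕ.* (a ! ℕ.* b ! ℕ.* c !) ≡ N !
multinomial-spec a b c refl with a + b + c ℕ.≟ a + b + c
... | yes _ = m/n*n≡m {{a!*b!*c!≢0 a b c}} (multinomial-∣ a b c)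
... | no a+b+c≢a+b+c = contradiction refl a+b+c≢a+b+c

binomial-spec : ∀ k t → ((k + t) C k) ℕ.* (k ! ℕ.* t !) ≡ (k + t) !
binomial-spec k t = begin
  ((k + t) C k) ℕ.* (k ! ℕ.* t !)
    ≡⟨ cong (ℕ._* (k ! ℕ.* t !)) (nCk≡n!/k![n-k]! (m≤m+n k t)) ⟩
  ((k + t) ! / (k ! ℕ.* (k + t ∸ k) !)) {{a!*b!≢0 k (k + t ∸ k)}} ℕ.* (k ! ℕ.* t !)
    ≡⟨ cong (λ s → ((k + t) ! / (k ! ℕ.* s !)) {{a!*b!≢0 k s}} ℕ.* (k ! ℕ.* t !)) (m+n∸m≡n k t) ⟩
  ((k + t) ! / (k ! ℕ.* t !)) {{a!*b!≢0 k t}} ℕ.* (k ! ℕ.* t !)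
    ≡⟨ m/n*n≡m {{a!*b!≢0 k t}} (binomial-∣ k t) ⟩
  (k + t) ! ∎
  where open ≡-Reasoning

multinomial-binomial : ∀ k t → multinomial (k + t) k t 0 ≡ (k + t) C k
multinomial-binomial k t = ℕ.*-cancelʳ-≡ _ _ (k ! ℕ.* t ! ℕ.* 1) {{a!*b!*c!≢0 k t 0}} (begin
  multinomial (k + t) k t 0 ℕ.* (k ! ℕ.* t ! ℕ.* 1)   ≡⟨ multinomial-spec k t 0 (ℕ.+-identityʳ (k + t)) ⟩
  (k + t) !                                            ≡⟨ binomial-spec k t ⟨
  ((k + t) C k) ℕ.* (k ! ℕ.* t !)                      ≡⟨ cong (((k + t) C k) ℕ.*_) (ℕ.*-identityʳ _) ⟨
  ((k + t) C k) ℕ.* (k ! ℕ.* t ! ℕ.* 1)                ∎)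
  where open ≡-Reasoning

multinomial-shift : ∀ {N} j b c → 2 + j + b + c ≡ N →
  multinomial N j (suc b) (suc c) ℕ.* (suc b ℕ.* suc c) ≡ multinomial N (2 + j) b c ℕ.* ((2 + j) ℕ.* (1 + j))
multinomial-shift {N} j b c 2+j+b+c≡N = ℕ.*-cancelʳ-≡ _ _ (j ! ℕ.* b ! ℕ.* c !) {{a!*b!*c!≢0 j b c}} (begin
  m ℕ.* (suc b ℕ.* suc c) ℕ.* (j ! ℕ.* b ! ℕ.* c !)          ≡⟨ regroupˡ m b c (j !) (b !) (c !) ⟩
  m ℕ.* (j ! ℕ.* suc b ! ℕ.* suc c !)                         ≡⟨ multinomial-spec j (suc b) (suc c) j+[1+b]+[1+c]≡N ⟩
  N !                                                         ≡⟨ multinomial-spec (2 + j) b c 2+j+b+c≡N ⟨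
  m′ ℕ.* ((2 + j) ! ℕ.* b ! ℕ.* c !)                          ≡⟨ regroupʳ m′ j (j !) (b !) (c !) ⟨
  m′ ℕ.* ((2 + j) ℕ.* (1 + j)) ℕ.* (j ! ℕ.* b ! ℕ.* c !)     ∎)
  where
  open ≡-Reasoning
  m m′ : ℕ
  m  = multinomial N j (suc b) (suc c)
  m′ = multinomial N (2 + j) b c
  j+[1+b]+[1+c]≡N : j + suc b + suc c ≡ N
  j+[1+b]+[1+c]≡N = trans (reorder j b c) 2+j+b+c≡N
    where
    reorder : ∀ j b c → j + suc b + suc c ≡ 2 + j + b + c
    reorder = ℕ-Solver.solve-∀
  regroupˡ : ∀ m b c x y z →
    m ℕ.* (suc b ℕ.* suc c) ℕ.* (x ℕ.* y ℕ.* z) ≡ m ℕ.* (x ℕ.* (suc b ℕ.* y) ℕ.* (suc c ℕ.* z))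
  regroupˡ = ℕ-Solver.solve-∀
  regroupʳ : ∀ m j x y z →
    m ℕ.* ((2 + j) ℕ.* (1 + j)) ℕ.* (x ℕ.* y ℕ.* z) ≡ m ℕ.* ((2 + j) ℕ.* ((1 + j) ℕ.* x) ℕ.* y ℕ.* z)
  regroupʳ = ℕ-Solver.solve-∀

multinomial-shift-≤ : ∀ {i} j c t → i ≡ 2 + j + c ℕ.* 2 →
  multinomial (i + t) j (suc c + t) (suc c) ℕ.* suc t
    ℕ.≤ i ℕ.* (i ∸ 1) ℕ.* multinomial (i + t) (2 + j) (c + t) c
multinomial-shift-≤ j c t refl = begin
  m ℕ.* suc t                                ≤⟨ ℕ.*-monoʳ-≤ m 1+t≤[1+c+t]*[1+c] ⟩
  m ℕ.* (suc (c + t) ℕ.* suc c)              ≡⟨ multinomial-shift j (c + t) c (reorder j c t) ⟩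
  m′ ℕ.* ((2 + j) ℕ.* (1 + j))
    ≤⟨ ℕ.*-monoʳ-≤ m′ (ℕ.*-mono-≤ (m≤m+n (2 + j) (c ℕ.* 2)) (s≤s (m≤m+n j (c ℕ.* 2)))) ⟩
  m′ ℕ.* (i ℕ.* (i ∸ 1))                     ≡⟨ ℕ.*-comm m′ _ ⟩
  i ℕ.* (i ∸ 1) ℕ.* m′                       ∎
  where
  open ℕ.≤-Reasoning
  i m m′ : ℕ
  i  = 2 + j + c ℕ.* 2
  m  = multinomial (i + t) j (suc c + t) (suc c)
  m′ = multinomial (i + t) (2 + j) (c + t) c
  1+t≤[1+c+t]*[1+c] : suc t ℕ.≤ suc (c + t) ℕ.* suc c
  1+t≤[1+c+t]*[1+c] = ℕ.≤-trans (s≤s (ℕ.m≤n+m t c)) (ℕ.m≤m*n (suc (c + t)) (suc c))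
  reorder : ∀ j c t → 2 + j + (c + t) + c ≡ 2 + j + c ℕ.* 2 + t
  reorder = ℕ-Solver.solve-∀

even-or-odd : ∀ n → ∃[ k ] (n ≡ k ℕ.* 2 ⊎ n ≡ suc (k ℕ.* 2))
even-or-odd zero = 0 , inj₁ refl
even-or-odd (suc n) with even-or-odd n
... | k , inj₁ n≡2k   = k , inj₂ (cong suc n≡2k)
... | k , inj₂ n≡1+2k = suc k , inj₁ (cong suc n≡1+2k)

n≡k*2⇒n/2≡k : ∀ {n} k → n ≡ k ℕ.* 2 → n / 2 ≡ k
n≡k*2⇒n/2≡k k refl = m*n/n≡m k 2

lhsTerm-even : ∀ {i j c} t p → i ≡ j + c ℕ.* 2 →
  lhsTerm (i + t) p i j ≡ (ℕ→ℚ 2 * p) ^ℚ j * ℕ→ℚ (multinomial (i + t) j (c + t) c)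
lhsTerm-even {i} {j} {c} t p refl with (i ∸ j) % 2 ℕ.≟ 0
... | yes _    = cong₂ (λ x y → (ℕ→ℚ 2 * p) ^ℚ j * ℕ→ℚ (multinomial (i + t) j x y))
                       (n≡k*2⇒n/2≡k (c + t) [n-i-j]≡[c+t]*2) (n≡k*2⇒n/2≡k c [i-j]≡c*2)
  where
  open ≡-Reasoning
  [i-j]≡c*2 : i ∸ j ≡ c ℕ.* 2
  [i-j]≡c*2 = m+n∸m≡n j (c ℕ.* 2)
  [n-i-j]≡[c+t]*2 : 2 ℕ.* (i + t) ∸ i ∸ j ≡ (c + t) ℕ.* 2
  [n-i-j]≡[c+t]*2 = begin
    2 ℕ.* (i + t) ∸ i ∸ j             ≡⟨ cong (λ n → n ∸ i ∸ j) (reorder j c t) ⟩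
    (c + t) ℕ.* 2 + j + i ∸ i ∸ j     ≡⟨ cong (_∸ j) (m+n∸n≡m _ i) ⟩
    (c + t) ℕ.* 2 + j ∸ j             ≡⟨ m+n∸n≡m _ j ⟩
    (c + t) ℕ.* 2                     ∎
    where
    reorder : ∀ j c t → 2 ℕ.* (j + c ℕ.* 2 + t) ≡ (c + t) ℕ.* 2 + j + (j + c ℕ.* 2)
    reorder = ℕ-Solver.solve-∀
... | no i-j≢0 = contradiction (trans (cong (_% 2) (m+n∸m≡n j (c ℕ.* 2))) (m*n%n≡0 c 2)) i-j≢0

lhsTerm-odd : ∀ {i j c} N p → i ≡ j + suc (c ℕ.* 2) → lhsTerm N p i j ≡ 0ℚ
lhsTerm-odd {i} {j} {c} N p refl with (i ∸ j) % 2 ℕ.≟ 0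
... | yes [i-j]%2≡0 = contradiction 1%2≡0 λ ()
  where
  1%2≡0 : 1 % 2 ≡ 0
  1%2≡0 = trans (sym ([m+kn]%n≡m%n 1 c 2)) (trans (cong (_% 2) (sym (m+n∸m≡n j _))) [i-j]%2≡0)
... | no _ = refl

lhsTerm-nonNeg : ∀ N {p} i j → 0ℚ ≤ p → 0ℚ ≤ lhsTerm N p i j
lhsTerm-nonNeg N i j p≥0 with (i ∸ j) % 2 ℕ.≟ 0
... | yes _ = *-nonNeg (^ℚ-nonNeg (*-nonNeg (ℕ→ℚ-nonNeg 2) p≥0) j)
                       (ℕ→ℚ-nonNeg (multinomial N j ((2 ℕ.* N ∸ i ∸ j) / 2) ((i ∸ j) / 2)))
... | no _  = ℚ.≤-refl

lhsTerm-diagonal : ∀ i t p → lhsTerm (i + t) p i i ≡ (ℕ→ℚ 2 * p) ^ℚ i * ℕ→ℚ ((i + t) C i)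
lhsTerm-diagonal i t p = trans (lhsTerm-even {c = 0} t p (sym (ℕ.+-identityʳ i)))
                               (cong (λ b → (ℕ→ℚ 2 * p) ^ℚ i * ℕ→ℚ b) (multinomial-binomial i t))

lhsTerm-step-even : ∀ {i j c} t {p d} → i ≡ 2 + j + c ℕ.* 2 → 0ℚ ≤ p →
  d * (ℕ→ℚ 2 * (p * p) * ℕ→ℚ (2 ℕ.* suc t)) ≡ ℕ→ℚ (i ℕ.* (i ∸ 1)) →
  lhsTerm (i + t) p i j ≤ d * lhsTerm (i + t) p i (2 + j)
lhsTerm-step-even {i} {j} {c} t {p} {d} i≡2+j+2c p≥0 d-def =
  subst₂ (λ u v → u ≤ d * v)
    (sym (lhsTerm-even {j = j} {c = suc c} t p (trans i≡2+j+2c (reorder j c))))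
    (sym (lhsTerm-even {j = 2 + j} {c = c} t p i≡2+j+2c))
    (*-cancelʳ-≤-pos K {{ℕ→ℚ-pos (suc t)}} (begin
      P * ℕ→ℚ m * K                                    ≡⟨ ℚ.*-assoc P _ K ⟩
      P * (ℕ→ℚ m * K)                                  ≡⟨ cong (P *_) (ℕ→ℚ-homo-* m (suc t)) ⟨
      P * ℕ→ℚ (m ℕ.* suc t)
        ≤⟨ *-monoˡ-≤-nonNeg P {{nonNegative P≥0}} (ℕ→ℚ-mono-≤ (multinomial-shift-≤ j c t i≡2+j+2c)) ⟩
      P * ℕ→ℚ (i ℕ.* (i ∸ 1) ℕ.* m′)                   ≡⟨ cong (P *_) (ℕ→ℚ-homo-* (i ℕ.* (i ∸ 1)) m′) ⟩
      P * (ℕ→ℚ (i ℕ.* (i ∸ 1)) * ℕ→ℚ m′)               ≡⟨ cong (λ r → P * (r * ℕ→ℚ m′)) d-def ⟨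
      P * (d * (ℕ→ℚ 2 * (p * p) * ℕ→ℚ (2 ℕ.* suc t)) * ℕ→ℚ m′)
        ≡⟨ cong (λ r → P * (d * (ℕ→ℚ 2 * (p * p) * r) * ℕ→ℚ m′)) (ℕ→ℚ-homo-* 2 (suc t)) ⟩
      P * (d * (ℕ→ℚ 2 * (p * p) * (ℕ→ℚ 2 * K)) * ℕ→ℚ m′) ≡⟨ regroup P d (ℕ→ℚ 2) p (ℕ→ℚ m′) K ⟩
      d * ((ℕ→ℚ 2 * p) ^ℚ (2 + j) * ℕ→ℚ m′) * K         ∎))
  where
  open ℚ.≤-Reasoning
  K P : ℚ
  K  = ℕ→ℚ (suc t)
  P  = (ℕ→ℚ 2 * p) ^ℚ j
  m m′ : ℕ
  m  = multinomial (i + t) j (suc c + t) (suc c)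
  m′ = multinomial (i + t) (2 + j) (c + t) c
  P≥0 : 0ℚ ≤ P
  P≥0 = ^ℚ-nonNeg (*-nonNeg (ℕ→ℚ-nonNeg 2) p≥0) j
  reorder : ∀ j c → 2 + j + c ℕ.* 2 ≡ j + suc c ℕ.* 2
  reorder = ℕ-Solver.solve-∀
  regroup : ∀ P d two p M K → P * (d * (two * (p * p) * (two * K)) * M) ≡ d * (two * p * (two * p * P) * M) * K
  regroup = solve-∀ ℚ-ring

lhsTerm-step : ∀ {i j} t {p d} → 0ℚ ≤ p → 0ℚ ≤ d →
  d * (ℕ→ℚ 2 * (p * p) * ℕ→ℚ (2 ℕ.* suc t)) ≡ ℕ→ℚ (i ℕ.* (i ∸ 1)) → 2 + j ℕ.≤ i →
  lhsTerm (i + t) p i j ≤ d * lhsTerm (i + t) p i (2 + j)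
lhsTerm-step {i} {j} t {p} {d} p≥0 d≥0 d-def 2+j≤i with even-or-odd (i ∸ (2 + j))
... | c , inj₁ r≡2c =
  lhsTerm-step-even {j = j} {c = c} t {p} {d} (trans i≡2+j+r (cong (λ r → 2 + j + r) r≡2c)) p≥0 d-def
  where
  i≡2+j+r : i ≡ 2 + j + (i ∸ (2 + j))
  i≡2+j+r = sym (m+[n∸m]≡n 2+j≤i)
... | c , inj₂ r≡1+2c = subst (_≤ d * lhsTerm (i + t) p i (2 + j)) (sym Uj≡0)
                              (*-nonNeg d≥0 (lhsTerm-nonNeg (i + t) i (2 + j) p≥0))
  where
  reorder : ∀ j c → 2 + j + suc (c ℕ.* 2) ≡ j + suc (suc c ℕ.* 2)
  reorder = ℕ-Solver.solve-∀
  i≡j+odd : i ≡ j + suc (suc c ℕ.* 2)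
  i≡j+odd = trans (sym (m+[n∸m]≡n 2+j≤i)) (trans (cong (λ r → 2 + j + r) r≡1+2c) (reorder j c))
  Uj≡0 : lhsTerm (i + t) p i j ≡ 0ℚ
  Uj≡0 = lhsTerm-odd {j = j} {c = suc c} (i + t) p i≡j+odd

lhsSum-≤ : ∀ i t {p d q} → 0ℚ ≤ p → 0ℚ ≤ d → 1ℚ ≤ q → q ≡ 1ℚ ℚ.+ q * d →
  d * (ℕ→ℚ 2 * (p * p) * ℕ→ℚ (2 ℕ.* suc t)) ≡ ℕ→ℚ (i ℕ.* (i ∸ 1)) →
  lhsSum (i + t) p i ≤ q * lhsTerm (i + t) p i i
lhsSum-≤ zero t {p} {q = q} p≥0 _ 1≤q _ _ =
  subst (_≤ q * lhsTerm t p 0 0) (sym (ℚ.+-identityʳ _)) (x≤q*x 1≤q (lhsTerm-nonNeg t 0 0 p≥0))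
lhsSum-≤ (suc n) t {p} {q = q} p≥0 d≥0 1≤q q≡1+qd d-def = begin
  lhsSum (suc n + t) p (suc n)      ≤⟨ sumℚ-upTo-≤-last-two U (λ j → lhsTerm-nonNeg _ _ j p≥0) 1≤q q≡1+qd n
                                         (λ j → lhsTerm-step t p≥0 d≥0 d-def) ⟩
  q * U (suc n) ℚ.+ q * U n
    ≡⟨ cong (λ u → q * U (suc n) ℚ.+ q * u) (lhsTerm-odd {j = n} {c = 0} _ p (sym (ℕ.+-comm n 1))) ⟩
  q * U (suc n) ℚ.+ q * 0ℚ          ≡⟨ cong (q * U (suc n) ℚ.+_) (ℚ.*-zeroʳ q) ⟩
  q * U (suc n) ℚ.+ 0ℚ              ≡⟨ ℚ.+-identityʳ _ ⟩
  q * U (suc n)                     ∎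
  where
  open ℚ.≤-Reasoning
  U : ℕ → ℚ
  U = lhsTerm (suc n + t) p (suc n)

module _ {N : ℕ} where

  private
    2N+2≡2[1+N] : 2 ℕ.* N + 2 ≡ 2 ℕ.* suc N
    2N+2≡2[1+N] = trans (ℕ.+-comm (2 ℕ.* N) 2) (sym (ℕ.*-suc 2 N))

  square-bound⇒≤ : ∀ {i} a → 2 ℕ.* i ℕ.≤ 2 ℕ.* N + 2 →
    ℕ→ℚ (i ℕ.* i) ≤ a * ℕ→ℚ (2 ℕ.* N + 2 ∸ 2 ℕ.* i) → i ℕ.≤ N
  square-bound⇒≤ {i} a 2i≤2N+2 i²≤aM
    with ℕ.m≤n⇒m<n∨m≡n (ℕ.*-cancelˡ-≤ 2 (subst (2 ℕ.* i ℕ.≤_) 2N+2≡2[1+N] 2i≤2N+2))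
  ... | inj₁ i<1+N = s≤s⁻¹ i<1+N
  ... | inj₂ refl  = ⊥-elim (ℚ.<-irrefl refl (ℚ.<-≤-trans (positive⁻¹ _ {{ℕ→ℚ-pos (i ℕ.* i)}}) (begin
    ℕ→ℚ (i ℕ.* i)                      ≤⟨ i²≤aM ⟩
    a * ℕ→ℚ (2 ℕ.* N + 2 ∸ 2 ℕ.* i)
      ≡⟨ cong (λ n → a * ℕ→ℚ n) (ℕ.m≤n⇒m∸n≡0 (ℕ.≤-reflexive 2N+2≡2[1+N])) ⟩
    a * 0ℚ                              ≡⟨ ℚ.*-zeroʳ a ⟩
    0ℚ                                  ∎)))
    where open ℚ.≤-Reasoning

2[i+t]+2∸2i≡2[1+t] : ∀ i t → 2 ℕ.* (i + t) + 2 ∸ 2 ℕ.* i ≡ 2 ℕ.* suc t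
2[i+t]+2∸2i≡2[1+t] i t = trans (cong (_∸ 2 ℕ.* i) (reorder i t)) (m+n∸n≡m (2 ℕ.* suc t) (2 ℕ.* i))
  where
  reorder : ∀ i t → 2 ℕ.* (i + t) + 2 ≡ 2 ℕ.* suc t + 2 ℕ.* i
  reorder = ℕ-Solver.solve-∀

mainTheorem11 : (N : ℕ) → 1 ℕ.≤ N → (p : ℚ) → 0ℚ < p → p ≤ 1ℚ → (i : ℕ) →
    2 ℕ.* i ℕ.≤ 2 ℕ.* N + 2 →
    ℕ→ℚ (i ℕ.* i) ≤ (p * p) * ℕ→ℚ (2 ℕ.* N + 2 ∸ 2 ℕ.* i) →
    (d : ℚ) → d * (ℕ→ℚ 2 * (p * p) * ℕ→ℚ (2 ℕ.* N + 2 ∸ 2 ℕ.* i)) ≡ ℕ→ℚ (i ℕ.* (i ∸ 1)) →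
    (q : ℚ) → q * (1ℚ - d) ≡ 1ℚ →
    lhsSum N p i ≤ q * (((ℕ→ℚ 2 * p) ^ℚ i) * ℕ→ℚ (N C i))
mainTheorem11 N _ p p>0 _ i 2i≤2N+2 i²≤p²M d d-def q q*[1-d]≡1
  with m≤n⇒∃[o]m+o≡n {i} {N} (square-bound⇒≤ (p * p) 2i≤2N+2 i²≤p²M)
... | t , refl rewrite 2[i+t]+2∸2i≡2[1+t] i t = begin
  lhsSum (i + t) p i                          ≤⟨ lhsSum-≤ i t p≥0 d≥0 1≤q q≡1+qd d-def ⟩
  q * lhsTerm (i + t) p i i                   ≡⟨ cong (q *_) (lhsTerm-diagonal i t p) ⟩
  q * ((ℕ→ℚ 2 * p) ^ℚ i * ℕ→ℚ ((i + t) C i))  ∎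
  where
  open ℚ.≤-Reasoning
  instance
    p*p>0 : Positive (p * p)
    p*p>0 = pos*pos⇒pos p {{positive p>0}} p {{positive p>0}}
    M>0 : Positive (ℕ→ℚ (2 ℕ.* suc t))
    M>0 = ℕ→ℚ-pos (2 ℕ.* suc t)
  open QuotientBounds {p * p} {ℕ→ℚ (2 ℕ.* suc t)} {d} {i ℕ.* (i ∸ 1)} d-def
  p≥0 : 0ℚ ≤ p
  p≥0 = ℚ.<⇒≤ p>0
  d≥0 : 0ℚ ≤ d
  d≥0 = quotient-nonNeg
  i[i-1]≤p²M : ℕ→ℚ (i ℕ.* (i ∸ 1)) ≤ p * p * ℕ→ℚ (2 ℕ.* suc t)
  i[i-1]≤p²M = ℚ.≤-trans (ℕ→ℚ-mono-≤ (ℕ.*-monoʳ-≤ i (ℕ.m∸n≤m i 1))) i²≤p²M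
  1≤q : 1ℚ ≤ q
  1≤q = q*[1-d]≡1⇒1≤q {d} {q} d≥0 (quotient-<1 i[i-1]≤p²M) q*[1-d]≡1
  q≡1+qd : q ≡ 1ℚ ℚ.+ q * d
  q≡1+qd = q*[1-d]≡1⇒q≡1+q*d {d} {q} q*[1-d]≡1
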